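{- Let $I$ be a finite set of positive integers, $J \subseteq I$, and $A \subseteq \mathbb{F}_2^I$ non-empty. Then $\sigma[C_J(A)] \leq \sigma[A]$.
   Context: $\mathbb{F}_2^I$ is the vector space of tuples $(x_i)_{i\in I}$ over $\mathbb{F}_2$; $\sigma[A]:=|A+A|/|A|$. Lex order on $\mathbb{F}_2^J$: $x\prec y$ iff at the largest $j$ with $x_j\ne y_j$ one has $x_j=0,y_j=1$. Writing $\mathbb{F}_2^I=\mathbb{F}_2^{I\setminus J}\times\mathbb{F}_2^J$ and, for $x\in\mathbb{F}_2^{I\setminus J}$, $A_x=\{y\in\mathbb{F}_2^J:(x,y)\in A\}$, the $J$-compression $C_J(A)$ is obtained by replacing each fibre $A_x$ by the first $|A_x|$ elements of $\mathbb{F}_2^J$ in lex order. -}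

module Defs where

open import Data.Bool using (Bool; true; false; _∧_; _∨_; _xor_; not; if_then_else_)
open import Data.Nat using (ℕ; zero; suc; _<ᵇ_)
open import Data.List using (List; []; _∷_; map; concatMap; filter; length)
open import Data.Bool.ListAction using (any)
open import Data.Vec using (Vec; []; _∷_; zipWith)
open import Data.Fin.Subset using (Subset)
open import Data.Bool.Properties using (T?)

-- Index set I = {0,...,n-1} (an order-preserving relabelling of a finite
-- set of positive integers).  F₂ = Bool, F₂^I = Vec Bool n, with the
-- coordinate of index i stored at position i of the vector.
F₂^ : ℕ → Set
F₂^ n = Vec Bool n

allVecs : (n : ℕ) → List (F₂^ n)
allVecs zero    = [] ∷ []
allVecs (suc n) = concatMap (λ v → (false ∷ v) ∷ (true ∷ v) ∷ []) (allVecs n)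

SubsetF₂ : ℕ → Set
SubsetF₂ n = F₂^ n → Bool

card : ∀ {n} → SubsetF₂ n → ℕ
card {n} A = length (filter (λ v → T? (A v)) (allVecs n))

_⊕_ : ∀ {n} → F₂^ n → F₂^ n → F₂^ n
_⊕_ = zipWith _xor_

sumset : ∀ {n} → SubsetF₂ n → SubsetF₂ n
sumset {n} A z = any (λ a → A a ∧ A (z ⊕ a)) (allVecs n)

-- x and y agree on all coordinates outside J (same fibre index in F₂^{I∖J}).
agreeOff : ∀ {n} → Subset n → F₂^ n → F₂^ n → Bool
agreeOff []          []      []      = true
agreeOff (inJ ∷ J)   (a ∷ x) (b ∷ y) =
  (inJ ∨ not (a xor b)) ∧ agreeOff J x y

agreeOn : ∀ {n} → Subset n → F₂^ n → F₂^ n → Bool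
agreeOn []          []      []      = true
agreeOn (inJ ∷ J)   (a ∷ x) (b ∷ y) =
  (not inJ ∨ not (a xor b)) ∧ agreeOn J x y

-- Lex order on the J-coordinates: x|_J ≺ y|_J iff at the largest j ∈ J
-- with x_j ≠ y_j one has x_j = 0, y_j = 1.  (Higher positions are compared
-- first, since they are larger indices.)
lexLt : ∀ {n} → Subset n → F₂^ n → F₂^ n → Bool
lexLt []        []      []      = false
lexLt (inJ ∷ J) (a ∷ x) (b ∷ y) =
  lexLt J x y ∨ (agreeOn J x y ∧ inJ ∧ not a ∧ b)

-- J-compression C_J(A): z ∈ C_J(A) iff z|_J is among the first |A_x|
-- elements of F₂^J in lex order, where x = z|_{I∖J}; i.e. the number of
-- elements of F₂^J lex-preceding z|_J is < |A_x|.
compress : ∀ {n} → Subset n → SubsetF₂ n → SubsetF₂ n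
compress {n} J A z =
  length (filter (λ w → T? (agreeOff J z w ∧ lexLt J w z)) (allVecs n))
  <ᵇ
  length (filter (λ w → T? (agreeOff J z w ∧ A w)) (allVecs n))

{-# OPTIONS --safe #-}
-- Number the points of F₂^J by their binary value, which orders them lexicographically; then
-- C_J(A) replaces every fibre A_x by the initial segment I(|A_x|), so |C_J(A)| = |A|.
-- The heart of the proof is that initial segments minimise sumsets: |I(|X|) + I(|Y|)| ≤ |X + Y|
-- for all X, Y ⊆ F₂^d.  By induction on d, split X and Y into halves by the lowest coordinate.
-- Each half of X + Y contains two sums of halves, so |X + Y| is bounded below by the sum of two
-- maxima of s(x, y) = |I(x) + I(y)| over the half sizes, with equality when the halves are
-- initial segments (sums of downsets are downsets, and downsets are nested).  As I(x) has halves
-- I(⌈x/2⌉) and I(⌊x/2⌋), it remains to see that no split x₀ + x₁ beats this balanced one: for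
-- halves I(x₀), I(x₁) the linear shear (c, q, r) ↦ (c + q, q, r) gives a set with the same
-- sumset size and balanced half sizes ⌈x₀/2⌉ + ⌊x₁/2⌋, ⌈x₁/2⌉ + ⌊x₀/2⌋, to which the induction
-- hypothesis applies.
-- Finally, a point u of the fibre of C_J(A) + C_J(B) over z is a sum of points of I(|A_a|) and
-- I(|B_{a+z}|), a downset of size at most |A_a + B_{a+z}| ≤ |(A + B)_z|, so that fibre lies in
-- an initial segment of length |(A + B)_z|.
module Submission where

open import Defs
open import Algebra.Bundles using (CommutativeMonoid; CommutativeRing)
open import Data.Bool using (Bool; true; false; _∧_; _∨_; _xor_; not; T)
open import Data.Bool.Properties
  using ( T?; T-∧; T-∨; T-≡; ⇔→≡; ∨-assoc; ∨-identityʳ; ∨-commutativeMonoid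
        ; xor-comm; xor-assoc; xor-same; xor-identityʳ; xor-∧-commutativeRing)
open import Data.Bool.ListAction using (any)
open import Data.Empty using (⊥-elim)
open import Data.Fin.Subset using (Subset; ∣_∣)
open import Data.List using (List; []; _∷_; concatMap; filter; length)
open import Data.Nat
  using (ℕ; zero; suc; _+_; _*_; _^_; _≤_; _<_; _<ᵇ_; _⊔_; z≤n; s≤s; s≤s⁻¹; ⌊_/2⌋; ⌈_/2⌉)
open import Data.Nat.Properties
open import Data.Product using (∃; ∃₂; _×_; _,_; proj₁; proj₂)
open import Data.Sum using (_⊎_; inj₁; inj₂)
import Data.Sum as Sum
open import Data.Unit using (tt)
open import Data.Vec using ([]; _∷_)
open import Data.Vec.Properties using (zipWith-comm)
open import Function using (_∘_; _⇔_; mk⇔; Equivalence)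
open import Relation.Binary.PropositionalEquality
  using (_≡_; refl; sym; trans; cong; cong₂; subst; subst₂; module ≡-Reasoning)
open import Relation.Binary.Definitions using (tri<; tri≈; tri>)
open import Relation.Nullary using (contradiction; yes; no)

import Algebra.Properties.CommutativeSemigroup as CommutativeSemigroupProperties
open CommutativeSemigroupProperties +-commutativeSemigroup
  using () renaming (interchange to +-interchange)
open CommutativeSemigroupProperties (CommutativeMonoid.commutativeSemigroup ∨-commutativeMonoid)
  using () renaming (interchange to ∨-interchange)
open CommutativeSemigroupProperties (CommutativeRing.+-commutativeSemigroup xor-∧-commutativeRing)
  using () renaming (interchange to xor-interchange)
open Equivalence using (to; from)

variable
  n d : ℕ

-- Counting subsets of F₂^n

bit : Bool → ℕ
bit false = 0
bit true  = 1

cubeSum : (n : ℕ) → (F₂^ n → ℕ) → ℕ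
cubeSum zero    f = f []
cubeSum (suc n) f = cubeSum n (f ∘ (false ∷_)) + cubeSum n (f ∘ (true ∷_))

count : (n : ℕ) → SubsetF₂ n → ℕ
count n P = cubeSum n (bit ∘ P)

cubeAny : (n : ℕ) → (F₂^ n → Bool) → Bool
cubeAny zero    f = f []
cubeAny (suc n) f = cubeAny n (f ∘ (false ∷_)) ∨ cubeAny n (f ∘ (true ∷_))

infix 4 _⊆_ _≐_

infixr 5 _∪_

_⊆_ : SubsetF₂ n → SubsetF₂ n → Set
P ⊆ Q = ∀ v → T (P v) → T (Q v)

_≐_ : SubsetF₂ n → SubsetF₂ n → Set
P ≐ Q = ∀ v → P v ≡ Q v

_∪_ : SubsetF₂ n → SubsetF₂ n → SubsetF₂ n
(P ∪ Q) v = P v ∨ Q v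

slice : Bool → SubsetF₂ (suc n) → SubsetF₂ n
slice b X v = X (b ∷ v)

T-injective : ∀ {a b} → (T a ⇔ T b) → a ≡ b
T-injective a⇔b = ⇔→≡ {z = true} (mk⇔ (to T-≡ ∘ to a⇔b ∘ from T-≡) (to T-≡ ∘ from a⇔b ∘ from T-≡))

cubeSum-mono : {f g : F₂^ n → ℕ} → (∀ v → f v ≤ g v) → cubeSum n f ≤ cubeSum n g
cubeSum-mono {zero}  f≤g = f≤g []
cubeSum-mono {suc n} f≤g = +-mono-≤ (cubeSum-mono (f≤g ∘ (false ∷_))) (cubeSum-mono (f≤g ∘ (true ∷_)))

cubeSum-cong : {f g : F₂^ n → ℕ} → (∀ v → f v ≡ g v) → cubeSum n f ≡ cubeSum n g
cubeSum-cong {zero}  f≗g = f≗g []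
cubeSum-cong {suc n} f≗g = cong₂ _+_ (cubeSum-cong (f≗g ∘ (false ∷_))) (cubeSum-cong (f≗g ∘ (true ∷_)))

cubeSum-+ : (f g : F₂^ n → ℕ) → cubeSum n (λ v → f v + g v) ≡ cubeSum n f + cubeSum n g
cubeSum-+ {zero}  f g = refl
cubeSum-+ {suc n} f g = trans
  (cong₂ _+_ (cubeSum-+ (f ∘ (false ∷_)) (g ∘ (false ∷_))) (cubeSum-+ (f ∘ (true ∷_)) (g ∘ (true ∷_))))
  (+-interchange (cubeSum n (f ∘ (false ∷_))) (cubeSum n (g ∘ (false ∷_)))
                 (cubeSum n (f ∘ (true ∷_))) (cubeSum n (g ∘ (true ∷_))))

bit-mono : ∀ {a b} → (T a → T b) → bit a ≤ bit b
bit-mono {false}         _   = z≤n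
bit-mono {true}  {true}  _   = ≤-refl
bit-mono {true}  {false} a⇒b = ⊥-elim (a⇒b tt)

count-mono : {P Q : SubsetF₂ n} → P ⊆ Q → count n P ≤ count n Q
count-mono P⊆Q = cubeSum-mono (λ v → bit-mono (P⊆Q v))

count-cong : {P Q : SubsetF₂ n} → P ≐ Q → count n P ≡ count n Q
count-cong P≐Q = cubeSum-cong (cong bit ∘ P≐Q)

count-empty : (n : ℕ) → count n (λ _ → false) ≡ 0
count-empty zero    = refl
count-empty (suc n) = cong₂ _+_ (count-empty n) (count-empty n)

count-full : (n : ℕ) → count n (λ _ → true) ≡ 2 ^ n
count-full zero    = refl
count-full (suc n) = cong₂ _+_ (count-full n) (trans (count-full n) (sym (+-identityʳ (2 ^ n))))

count≤2^ : (P : SubsetF₂ n) → count n P ≤ 2 ^ n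
count≤2^ {n} P = subst (count n P ≤_) (count-full n) (count-mono {n} {P} {λ _ → true} (λ _ _ → tt))

count-∪-⊔ : (P Q : SubsetF₂ n) → count n P ⊔ count n Q ≤ count n (P ∪ Q)
count-∪-⊔ P Q = ⊔-lub (count-mono {P = P} {P ∪ Q} (λ _ → from T-∨ ∘ inj₁))
                      (count-mono {P = Q} {P ∪ Q} (λ _ → from T-∨ ∘ inj₂))

cubeAny-cong : {f g : F₂^ n → Bool} → (∀ v → f v ≡ g v) → cubeAny n f ≡ cubeAny n g
cubeAny-cong {zero}  f≗g = f≗g []
cubeAny-cong {suc n} f≗g = cong₂ _∨_ (cubeAny-cong (f≗g ∘ (false ∷_))) (cubeAny-cong (f≗g ∘ (true ∷_)))

cubeAny-complete : (f : F₂^ n → Bool) (v : F₂^ n) → T (f v) → T (cubeAny n f)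
cubeAny-complete f []          fv = fv
cubeAny-complete f (false ∷ v) fv = from T-∨ (inj₁ (cubeAny-complete (f ∘ (false ∷_)) v fv))
cubeAny-complete f (true ∷ v)  fv = from T-∨ (inj₂ (cubeAny-complete (f ∘ (true ∷_)) v fv))

cubeAny-sound : (f : F₂^ n → Bool) → T (cubeAny n f) → ∃ λ v → T (f v)
cubeAny-sound {zero}  f any-f = [] , any-f
cubeAny-sound {suc n} f any-f with to T-∨ any-f
... | inj₁ any-f₀ = let v , fv = cubeAny-sound (f ∘ (false ∷_)) any-f₀ in false ∷ v , fv
... | inj₂ any-f₁ = let v , fv = cubeAny-sound (f ∘ (true ∷_)) any-f₁ in true ∷ v , fv

doubled : List (F₂^ n) → List (F₂^ (suc n))
doubled = concatMap (λ v → (false ∷ v) ∷ (true ∷ v) ∷ [])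

length-filter-∷ : (P : F₂^ n → Bool) (v : F₂^ n) (vs : List (F₂^ n)) →
  length (filter (T? ∘ P) (v ∷ vs)) ≡ bit (P v) + length (filter (T? ∘ P) vs)
length-filter-∷ P v vs with P v
... | true  = refl
... | false = refl

length-filter-doubled : (P : SubsetF₂ (suc n)) (vs : List (F₂^ n)) →
  length (filter (T? ∘ P) (doubled vs))
    ≡ length (filter (T? ∘ P ∘ (false ∷_)) vs) + length (filter (T? ∘ P ∘ (true ∷_)) vs)
length-filter-doubled P []       = refl
length-filter-doubled P (v ∷ vs) = begin
  length (filter (T? ∘ P) ((false ∷ v) ∷ (true ∷ v) ∷ doubled vs))
    ≡⟨ length-filter-∷ P (false ∷ v) _ ⟩
  b₀ + length (filter (T? ∘ P) ((true ∷ v) ∷ doubled vs))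
    ≡⟨ cong (b₀ +_) (length-filter-∷ P (true ∷ v) _) ⟩
  b₀ + (b₁ + length (filter (T? ∘ P) (doubled vs)))
    ≡⟨ cong (λ m → b₀ + (b₁ + m)) (length-filter-doubled P vs) ⟩
  b₀ + (b₁ + (l₀ + l₁))
    ≡⟨ +-assoc b₀ b₁ (l₀ + l₁) ⟨
  (b₀ + b₁) + (l₀ + l₁)
    ≡⟨ +-interchange b₀ b₁ l₀ l₁ ⟩
  (b₀ + l₀) + (b₁ + l₁)
    ≡⟨ cong₂ _+_ (length-filter-∷ (P ∘ (false ∷_)) v vs) (length-filter-∷ (P ∘ (true ∷_)) v vs) ⟨
  length (filter (T? ∘ P ∘ (false ∷_)) (v ∷ vs)) + length (filter (T? ∘ P ∘ (true ∷_)) (v ∷ vs)) ∎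
  where
  open ≡-Reasoning
  b₀ = bit (P (false ∷ v))
  b₁ = bit (P (true ∷ v))
  l₀ = length (filter (T? ∘ P ∘ (false ∷_)) vs)
  l₁ = length (filter (T? ∘ P ∘ (true ∷_)) vs)

any-doubled : (f : F₂^ (suc n) → Bool) (vs : List (F₂^ n)) →
  any f (doubled vs) ≡ any (f ∘ (false ∷_)) vs ∨ any (f ∘ (true ∷_)) vs
any-doubled f []       = refl
any-doubled f (v ∷ vs) = begin
  f (false ∷ v) ∨ (f (true ∷ v) ∨ any f (doubled vs))
    ≡⟨ cong (λ b → f (false ∷ v) ∨ (f (true ∷ v) ∨ b)) (any-doubled f vs) ⟩
  f (false ∷ v) ∨ (f (true ∷ v) ∨ (any (f ∘ (false ∷_)) vs ∨ any (f ∘ (true ∷_)) vs))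
    ≡⟨ ∨-assoc (f (false ∷ v)) (f (true ∷ v)) _ ⟨
  (f (false ∷ v) ∨ f (true ∷ v)) ∨ (any (f ∘ (false ∷_)) vs ∨ any (f ∘ (true ∷_)) vs)
    ≡⟨ ∨-interchange (f (false ∷ v)) (f (true ∷ v)) _ _ ⟩
  (f (false ∷ v) ∨ any (f ∘ (false ∷_)) vs) ∨ (f (true ∷ v) ∨ any (f ∘ (true ∷_)) vs) ∎
  where open ≡-Reasoning

length-filter-allVecs : (P : SubsetF₂ n) → length (filter (T? ∘ P) (allVecs n)) ≡ count n P
length-filter-allVecs {zero} P with P []
... | true  = refl
... | false = refl
length-filter-allVecs {suc n} P = trans (length-filter-doubled P (allVecs n))
  (cong₂ _+_ (length-filter-allVecs (P ∘ (false ∷_))) (length-filter-allVecs (P ∘ (true ∷_))))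

any-allVecs : (f : F₂^ n → Bool) → any f (allVecs n) ≡ cubeAny n f
any-allVecs {zero}  f = ∨-identityʳ (f [])
any-allVecs {suc n} f = trans (any-doubled f (allVecs n))
  (cong₂ _∨_ (any-allVecs (f ∘ (false ∷_))) (any-allVecs (f ∘ (true ∷_))))

card≡count : (A : SubsetF₂ n) → card A ≡ count n A
card≡count = length-filter-allVecs

infixl 6 _⊞_

-- Opaque so that X and Y can be inferred from a goal about (X ⊞ Y) z.
opaque
  _⊞_ : SubsetF₂ n → SubsetF₂ n → SubsetF₂ n
  _⊞_ {n} X Y z = cubeAny n (λ a → X a ∧ Y (z ⊕ a))

  ⊞-intro : {X Y : SubsetF₂ n} (z a : F₂^ n) → T (X a) → T (Y (z ⊕ a)) → T ((X ⊞ Y) z)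
  ⊞-intro {X = X} {Y} z a Xa Yz+a = cubeAny-complete (λ a → X a ∧ Y (z ⊕ a)) a (from T-∧ (Xa , Yz+a))

  ⊞-elim : {X Y : SubsetF₂ n} (z : F₂^ n) → T ((X ⊞ Y) z) → ∃ λ a → T (X a) × T (Y (z ⊕ a))
  ⊞-elim {X = X} {Y} z z∈X+Y =
    let a , XYa = cubeAny-sound (λ a → X a ∧ Y (z ⊕ a)) z∈X+Y in a , to T-∧ XYa

  ⊞-cong : {X X′ Y Y′ : SubsetF₂ n} → X ≐ X′ → Y ≐ Y′ → X ⊞ Y ≐ X′ ⊞ Y′
  ⊞-cong X≐X′ Y≐Y′ z = cubeAny-cong (λ a → cong₂ _∧_ (X≐X′ a) (Y≐Y′ (z ⊕ a)))

  sumset≐⊞ : (A : SubsetF₂ n) → sumset A ≐ A ⊞ A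
  sumset≐⊞ A z = any-allVecs (λ a → A a ∧ A (z ⊕ a))

  ⊞-slice : (X Y : SubsetF₂ (suc n)) (c : Bool) (z : F₂^ n) →
    (X ⊞ Y) (c ∷ z) ≡ (slice false X ⊞ slice c Y) z ∨ (slice true X ⊞ slice (not c) Y) z
  ⊞-slice X Y false z = refl
  ⊞-slice X Y true  z = refl

-- The group F₂^n and its binary order

⊕-comm : (s t : F₂^ n) → s ⊕ t ≡ t ⊕ s
⊕-comm = zipWith-comm xor-comm

xor-cancelʳ : ∀ a b → (a xor b) xor b ≡ a
xor-cancelʳ a b = trans (xor-assoc a b b) (trans (cong (a xor_) (xor-same b)) (xor-identityʳ a))

⊕-cancelʳ : (s t : F₂^ n) → (s ⊕ t) ⊕ t ≡ s
⊕-cancelʳ []      []      = refl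
⊕-cancelʳ (a ∷ s) (b ∷ t) = cong₂ _∷_ (xor-cancelʳ a b) (⊕-cancelʳ s t)

⊕-cancelˡ : (s t : F₂^ n) → s ⊕ (s ⊕ t) ≡ t
⊕-cancelˡ s t = trans (⊕-comm s (s ⊕ t)) (trans (cong (_⊕ s) (⊕-comm s t)) (⊕-cancelʳ t s))

-- The head of a vector is its coordinate of smallest index, so it is the least significant
-- bit, and val orders F₂^n exactly as the lex order of the compression does.
val : F₂^ n → ℕ
val []      = 0
val (b ∷ v) = bit b + val v * 2

bit≤1 : ∀ b → bit b ≤ 1
bit≤1 false = z≤n
bit≤1 true  = ≤-refl

bit-injective : ∀ {b c} → bit b ≡ bit c → b ≡ c
bit-injective {false} {false} _ = refl
bit-injective {true}  {true}  _ = refl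

bit<bit : ∀ {b c} → bit b < bit c → b ≡ false × c ≡ true
bit<bit {false} {true} _ = refl , refl
bit<bit {true}  {true} (s≤s ())

bit+*2<*2 : ∀ b {x y} → x < y → bit b + x * 2 < y * 2
bit+*2<*2 b {x} {y} x<y = begin-strict
  bit b + x * 2 ≤⟨ +-monoˡ-≤ (x * 2) (bit≤1 b) ⟩
  1 + x * 2     <⟨ n<1+n _ ⟩
  suc x * 2     ≤⟨ *-monoˡ-≤ 2 x<y ⟩
  y * 2         ∎
  where open ≤-Reasoning

bit+*2-< : ∀ b c {x y} → x < y → bit b + x * 2 < bit c + y * 2
bit+*2-< b c {y = y} x<y = <-≤-trans (bit+*2<*2 b x<y) (m≤n+m (y * 2) (bit c))

val<2^ : (v : F₂^ n) → val v < 2 ^ n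
val<2^         []      = s≤s z≤n
val<2^ {suc n} (b ∷ v) = subst (val (b ∷ v) <_) (*-comm (2 ^ n) 2) (bit+*2<*2 b (val<2^ v))

val-injective : (v w : F₂^ n) → val v ≡ val w → v ≡ w
val-injective []      []      _  = refl
val-injective (b ∷ v) (c ∷ w) eq with <-cmp (val v) (val w)
... | tri< v<w _ _ = contradiction eq (<⇒≢ (bit+*2-< b c v<w))
... | tri> _ _ w<v = contradiction (sym eq) (<⇒≢ (bit+*2-< c b w<v))
... | tri≈ _ v≡w _ = cong₂ _∷_ b≡c (val-injective v w v≡w)
  where
  b≡c : b ≡ c
  b≡c = bit-injective (+-cancelʳ-≡ (val w * 2) (bit b) (bit c)
          (subst (λ x → bit b + x * 2 ≡ bit c + val w * 2) v≡w eq))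

val-∷-<⁻ : ∀ {b c} (v w : F₂^ n) → val (b ∷ v) < val (c ∷ w) →
           val v < val w ⊎ (v ≡ w × b ≡ false × c ≡ true)
val-∷-<⁻ {b = b} {c} v w bv<cw with <-cmp (val v) (val w)
... | tri< v<w _ _ = inj₁ v<w
... | tri> _ _ w<v = contradiction bv<cw (<-asym (bit+*2-< c b w<v))
... | tri≈ _ v≡w _ with val-injective v w v≡w
...   | refl = inj₂ (refl , bit<bit (+-cancelʳ-< (val v * 2) (bit b) (bit c) bv<cw))

-- At the most significant bit where w and s ⊕ t differ, w has 0 and exactly one of s, t has 1,
-- say s; above that bit w ⊕ t agrees with s, so w ⊕ t < s.
<-⊕-split : (w s t : F₂^ n) → val w < val (s ⊕ t) → val (w ⊕ t) < val s ⊎ val (w ⊕ s) < val t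
<-⊕-split []      []      []      ()
<-⊕-split (b ∷ w) (c ∷ s) (e ∷ t) w<s+t with val-∷-<⁻ w (s ⊕ t) w<s+t
... | inj₁ w<s+t′ = Sum.map (bit+*2-< (b xor e) c) (bit+*2-< (b xor c) e) (<-⊕-split w s t w<s+t′)
<-⊕-split (false ∷ _) (true ∷ s) (false ∷ t) _ | inj₂ (refl , refl , _) =
  inj₁ (≤-reflexive (cong (λ u → suc (val u * 2)) (⊕-cancelʳ s t)))
<-⊕-split (false ∷ _) (false ∷ s) (true ∷ t) _ | inj₂ (refl , refl , _) =
  inj₂ (≤-reflexive (cong (λ u → suc (val u * 2)) (trans (cong (_⊕ s) (⊕-comm s t)) (⊕-cancelʳ t s))))
<-⊕-split (_ ∷ _) (true ∷ _)  (true ∷ _)  _ | inj₂ (_ , _ , ())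
<-⊕-split (_ ∷ _) (false ∷ _) (false ∷ _) _ | inj₂ (_ , _ , ())

-- Initial segments and downsets

segment : ℕ → SubsetF₂ n
segment x v = val v <ᵇ x

glue : SubsetF₂ n → SubsetF₂ n → SubsetF₂ (suc n)
glue X₀ X₁ (false ∷ v) = X₀ v
glue X₀ X₁ (true ∷ v)  = X₁ v

*2<ᵇ≡<ᵇ⌈/2⌉ : ∀ m x → (m * 2 <ᵇ x) ≡ (m <ᵇ ⌈ x /2⌉)
1+*2<ᵇ≡<ᵇ⌊/2⌋ : ∀ m x → (suc (m * 2) <ᵇ x) ≡ (m <ᵇ ⌊ x /2⌋)

*2<ᵇ≡<ᵇ⌈/2⌉ zero    zero    = refl
*2<ᵇ≡<ᵇ⌈/2⌉ zero    (suc x) = refl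
*2<ᵇ≡<ᵇ⌈/2⌉ (suc m) zero    = refl
*2<ᵇ≡<ᵇ⌈/2⌉ (suc m) (suc x) = 1+*2<ᵇ≡<ᵇ⌊/2⌋ m x

1+*2<ᵇ≡<ᵇ⌊/2⌋ m       zero          = refl
1+*2<ᵇ≡<ᵇ⌊/2⌋ m       (suc zero)    = refl
1+*2<ᵇ≡<ᵇ⌊/2⌋ zero    (suc (suc x)) = refl
1+*2<ᵇ≡<ᵇ⌊/2⌋ (suc m) (suc (suc x)) = 1+*2<ᵇ≡<ᵇ⌊/2⌋ m x

segment≐glue : (x : ℕ) → segment {suc n} x ≐ glue (segment ⌈ x /2⌉) (segment ⌊ x /2⌋)
segment≐glue x (false ∷ v) = *2<ᵇ≡<ᵇ⌈/2⌉ (val v) x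
segment≐glue x (true ∷ v)  = 1+*2<ᵇ≡<ᵇ⌊/2⌋ (val v) x

⌈/2⌉≤2^ : ∀ n {x} → x ≤ 2 ^ suc n → ⌈ x /2⌉ ≤ 2 ^ n
⌈/2⌉≤2^ n {x} x≤2^1+n = subst (⌈ x /2⌉ ≤_) (sym (n≡⌈n+n/2⌉ (2 ^ n)))
  (⌈n/2⌉-mono (subst (x ≤_) (cong (2 ^ n +_) (+-identityʳ (2 ^ n))) x≤2^1+n))

⌊/2⌋≤2^ : ∀ n {x} → x ≤ 2 ^ suc n → ⌊ x /2⌋ ≤ 2 ^ n
⌊/2⌋≤2^ n {x} x≤2^1+n = ≤-trans (⌊n/2⌋≤⌈n/2⌉ x) (⌈/2⌉≤2^ n x≤2^1+n)

count-segment : ∀ {x} → x ≤ 2 ^ n → count n (segment x) ≡ x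
count-segment {zero}  {zero}        _         = refl
count-segment {zero}  {suc zero}    _         = refl
count-segment {zero}  {suc (suc x)} (s≤s ())
count-segment {suc n} {x}           x≤2^1+n = begin
  count (suc n) (segment x)
    ≡⟨ count-cong {suc n} (segment≐glue x) ⟩
  count n (segment ⌈ x /2⌉) + count n (segment ⌊ x /2⌋)
    ≡⟨ cong₂ _+_ (count-segment {n} (⌈/2⌉≤2^ n x≤2^1+n))
                 (count-segment {n} (⌊/2⌋≤2^ n x≤2^1+n)) ⟩
  ⌈ x /2⌉ + ⌊ x /2⌋
    ≡⟨ +-comm ⌈ x /2⌉ ⌊ x /2⌋ ⟩
  ⌊ x /2⌋ + ⌈ x /2⌉
    ≡⟨ ⌊n/2⌋+⌈n/2⌉≡n x ⟩
  x ∎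
  where open ≡-Reasoning

count-segment-≤ : (x : ℕ) → count n (segment x) ≤ x
count-segment-≤ {n} x with x ≤? 2 ^ n
... | yes x≤2^n = ≤-reflexive (count-segment {n} x≤2^n)
... | no  x≰2^n = ≤-trans (count≤2^ (segment {n} x)) (<⇒≤ (≰⇒> x≰2^n))

IsDownset : SubsetF₂ n → Set
IsDownset {n} D = (v w : F₂^ n) → val w < val v → T (D v) → T (D w)

segment-isDownset : (x : ℕ) → IsDownset {n} (segment x)
segment-isDownset x v w w<v v<x = <⇒<ᵇ (<-trans w<v (<ᵇ⇒< (val v) x v<x))

⊞-isDownset : {X Y : SubsetF₂ n} → IsDownset X → IsDownset Y → IsDownset (X ⊞ Y)
⊞-isDownset {X = X} {Y} X↓ Y↓ v w w<v v∈X+Y with ⊞-elim v v∈X+Y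
... | a , Xa , Yv+a with <-⊕-split w (v ⊕ a) a (subst (λ u → val w < val u) (sym (⊕-cancelʳ v a)) w<v)
...   | inj₁ w+a<v+a = ⊞-intro w a Xa (Y↓ (v ⊕ a) (w ⊕ a) w+a<v+a Yv+a)
...   | inj₂ w+v+a<a = ⊞-intro w (w ⊕ (v ⊕ a)) (X↓ a (w ⊕ (v ⊕ a)) w+v+a<a Xa)
                         (subst (T ∘ Y) (sym (⊕-cancelˡ w (v ⊕ a))) Yv+a)

downset-val<count : {D : SubsetF₂ n} → IsDownset D → (v : F₂^ n) → T (D v) → val v < count n D
downset-val<count {n} {D} D↓ v Dv = begin-strict
  val v                            <⟨ n<1+n (val v) ⟩
  suc (val v)                      ≡⟨ count-segment {n} (val<2^ v) ⟨
  count n (segment (suc (val v)))  ≤⟨ count-mono {n} segment⊆D ⟩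
  count n D                        ∎
  where
  open ≤-Reasoning
  segment⊆D : segment (suc (val v)) ⊆ D
  segment⊆D w w≤v with m≤n⇒m<n∨m≡n (s≤s⁻¹ (<ᵇ⇒< (val w) (suc (val v)) w≤v))
  ... | inj₁ w<v = D↓ v w w<v Dv
  ... | inj₂ w≡v = subst (T ∘ D) (val-injective v w (sym w≡v)) Dv

count-∪-downsets : {D E : SubsetF₂ n} → IsDownset D → IsDownset E →
  count n (D ∪ E) ≤ count n D ⊔ count n E
count-∪-downsets {n} {D} {E} D↓ E↓ =
  ≤-trans (count-mono {n} D∪E⊆segment) (count-segment-≤ {n} (count n D ⊔ count n E))
  where
  D∪E⊆segment : D ∪ E ⊆ segment (count n D ⊔ count n E)
  D∪E⊆segment v v∈D∪E with to T-∨ v∈D∪E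
  ... | inj₁ Dv = <⇒<ᵇ (<-≤-trans (downset-val<count D↓ v Dv) (m≤m⊔n (count n D) (count n E)))
  ... | inj₂ Ev = <⇒<ᵇ (<-≤-trans (downset-val<count E↓ v Ev) (m≤n⊔m (count n D) (count n E)))

-- Initial segments minimise sumsets

count-⊞-slices : (X Y : SubsetF₂ (suc n)) → count (suc n) (X ⊞ Y) ≡
  count n (slice false X ⊞ slice false Y ∪ slice true X ⊞ slice true Y) +
  count n (slice false X ⊞ slice true Y ∪ slice true X ⊞ slice false Y)
count-⊞-slices {n} X Y =
  cong₂ _+_ (count-cong {n} (⊞-slice X Y false)) (count-cong {n} (⊞-slice X Y true))

segSumSize : (d x y : ℕ) → ℕ
segSumSize d x y = count d (segment x ⊞ segment y)

-- The size of X + Y ⊆ F₂^(1+d) when the two slices of X (resp. Y) are initial segments of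
-- lengths x₀, x₁ (resp. y₀, y₁): each slice of X + Y is the union of two nested downsets.
splitSegSumSize : (d x₀ x₁ y₀ y₁ : ℕ) → ℕ
splitSegSumSize d x₀ x₁ y₀ y₁ =
  (segSumSize d x₀ y₀ ⊔ segSumSize d x₁ y₁) + (segSumSize d x₀ y₁ ⊔ segSumSize d x₁ y₀)

SegmentsMinimal : ℕ → Set
SegmentsMinimal d = (X Y : SubsetF₂ d) → segSumSize d (count d X) (count d Y) ≤ count d (X ⊞ Y)

count-⊞-glue-≤ : (x₀ x₁ y₀ y₁ : ℕ) →
  count (suc d) (glue (segment x₀) (segment x₁) ⊞ glue (segment y₀) (segment y₁))
    ≤ splitSegSumSize d x₀ x₁ y₀ y₁
count-⊞-glue-≤ {d} x₀ x₁ y₀ y₁ =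
  ≤-trans (≤-reflexive (count-⊞-slices {d} X Y))
          (+-mono-≤ (count-∪-downsets (↓ x₀ y₀) (↓ x₁ y₁)) (count-∪-downsets (↓ x₀ y₁) (↓ x₁ y₀)))
  where
  X Y : SubsetF₂ (suc d)
  X = glue (segment x₀) (segment x₁)
  Y = glue (segment y₀) (segment y₁)
  ↓ : (x y : ℕ) → IsDownset {d} (segment x ⊞ segment y)
  ↓ x y = ⊞-isDownset (segment-isDownset x) (segment-isDownset y)

splitSegSumSize-≤-count-⊞ : SegmentsMinimal d → (X Y : SubsetF₂ (suc d)) →
  splitSegSumSize d (count d (slice false X)) (count d (slice true X))
                    (count d (slice false Y)) (count d (slice true Y))
    ≤ count (suc d) (X ⊞ Y)
splitSegSumSize-≤-count-⊞ {d} minimal X Y = begin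
  splitSegSumSize d (count d X₀) (count d X₁) (count d Y₀) (count d Y₁)
    ≤⟨ +-mono-≤ (⊔-mono-≤ (minimal X₀ Y₀) (minimal X₁ Y₁)) (⊔-mono-≤ (minimal X₀ Y₁) (minimal X₁ Y₀)) ⟩
  (count d (X₀ ⊞ Y₀) ⊔ count d (X₁ ⊞ Y₁)) + (count d (X₀ ⊞ Y₁) ⊔ count d (X₁ ⊞ Y₀))
    ≤⟨ +-mono-≤ (count-∪-⊔ (X₀ ⊞ Y₀) (X₁ ⊞ Y₁)) (count-∪-⊔ (X₀ ⊞ Y₁) (X₁ ⊞ Y₀)) ⟩
  count d (X₀ ⊞ Y₀ ∪ X₁ ⊞ Y₁) + count d (X₀ ⊞ Y₁ ∪ X₁ ⊞ Y₀)
    ≡⟨ count-⊞-slices X Y ⟨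
  count (suc d) (X ⊞ Y) ∎
  where
  open ≤-Reasoning
  X₀ = slice false X
  X₁ = slice true X
  Y₀ = slice false Y
  Y₁ = slice true Y

Balanced : ℕ → ℕ → ℕ → Set
Balanced x₀ x₁ x = (x₀ ≡ ⌈ x /2⌉ × x₁ ≡ ⌊ x /2⌋) ⊎ (x₀ ≡ ⌊ x /2⌋ × x₁ ≡ ⌈ x /2⌉)

balanced-≤1 : ∀ {x₀ x₁} → x₀ ≤ 1 → x₁ ≤ 1 → Balanced x₀ x₁ (x₀ + x₁)
balanced-≤1 z≤n       z≤n       = inj₁ (refl , refl)
balanced-≤1 z≤n       (s≤s z≤n) = inj₂ (refl , refl)
balanced-≤1 (s≤s z≤n) z≤n       = inj₁ (refl , refl)
balanced-≤1 (s≤s z≤n) (s≤s z≤n) = inj₁ (refl , refl)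

balanced-halves : ∀ p q → Balanced (⌈ p /2⌉ + ⌊ q /2⌋) (⌈ q /2⌉ + ⌊ p /2⌋) (p + q)
balanced-halves zero          q = inj₂ (refl , +-identityʳ ⌈ q /2⌉)
balanced-halves (suc zero)    q = inj₁ (refl , +-identityʳ ⌈ q /2⌉)
balanced-halves (suc (suc p)) q = Sum.map step step (balanced-halves p q)
  where
  step : ∀ {a b} → ⌈ p /2⌉ + ⌊ q /2⌋ ≡ a × ⌈ q /2⌉ + ⌊ p /2⌋ ≡ b →
         suc ⌈ p /2⌉ + ⌊ q /2⌋ ≡ suc a × ⌈ q /2⌉ + suc ⌊ p /2⌋ ≡ suc b
  step (e₀ , e₁) = cong suc e₀ , trans (+-suc ⌈ q /2⌉ ⌊ p /2⌋) (cong suc e₁)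

splitSegSumSize-swap₀ : ∀ d x₀ x₁ y₀ y₁ → splitSegSumSize d x₀ x₁ y₀ y₁ ≡ splitSegSumSize d x₁ x₀ y₀ y₁
splitSegSumSize-swap₀ d x₀ x₁ y₀ y₁ =
  trans (+-comm (segSumSize d x₀ y₀ ⊔ segSumSize d x₁ y₁) _)
        (cong₂ _+_ (⊔-comm (segSumSize d x₀ y₁) _) (⊔-comm (segSumSize d x₀ y₀) _))

splitSegSumSize-swap₁ : ∀ d x₀ x₁ y₀ y₁ → splitSegSumSize d x₀ x₁ y₀ y₁ ≡ splitSegSumSize d x₀ x₁ y₁ y₀
splitSegSumSize-swap₁ d x₀ x₁ y₀ y₁ = +-comm (segSumSize d x₀ y₀ ⊔ segSumSize d x₁ y₁) _

splitSegSumSize-balanced : ∀ {x₀ x₁ x y₀ y₁ y} → Balanced x₀ x₁ x → Balanced y₀ y₁ y →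
  splitSegSumSize d ⌈ x /2⌉ ⌊ x /2⌋ ⌈ y /2⌉ ⌊ y /2⌋ ≡ splitSegSumSize d x₀ x₁ y₀ y₁
splitSegSumSize-balanced         (inj₁ (refl , refl)) (inj₁ (refl , refl)) = refl
splitSegSumSize-balanced {d} {x = x} {y = y} (inj₂ (refl , refl)) (inj₁ (refl , refl)) =
  splitSegSumSize-swap₀ d ⌈ x /2⌉ ⌊ x /2⌋ ⌈ y /2⌉ ⌊ y /2⌋
splitSegSumSize-balanced {d} {x = x} {y = y} (inj₁ (refl , refl)) (inj₂ (refl , refl)) =
  splitSegSumSize-swap₁ d ⌈ x /2⌉ ⌊ x /2⌋ ⌈ y /2⌉ ⌊ y /2⌋
splitSegSumSize-balanced {d} {x = x} {y = y} (inj₂ (refl , refl)) (inj₂ (refl , refl)) =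
  trans (splitSegSumSize-swap₀ d ⌈ x /2⌉ ⌊ x /2⌋ ⌈ y /2⌉ ⌊ y /2⌋)
        (splitSegSumSize-swap₁ d ⌊ x /2⌋ ⌈ x /2⌉ ⌈ y /2⌉ ⌊ y /2⌋)

segSumSize-suc-≤-balanced : ∀ {x₀ x₁ x y₀ y₁ y} → Balanced x₀ x₁ x → Balanced y₀ y₁ y →
  segSumSize (suc d) x y ≤ splitSegSumSize d x₀ x₁ y₀ y₁
segSumSize-suc-≤-balanced {d} {x₀} {x₁} {x} {y₀} {y₁} {y} x-split y-split = begin
  count (suc d) (segment x ⊞ segment y)
    ≡⟨ count-cong {suc d} (⊞-cong (segment≐glue x) (segment≐glue y)) ⟩
  count (suc d) (glue (segment ⌈ x /2⌉) (segment ⌊ x /2⌋) ⊞ glue (segment ⌈ y /2⌉) (segment ⌊ y /2⌋))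
    ≤⟨ count-⊞-glue-≤ {d} ⌈ x /2⌉ ⌊ x /2⌋ ⌈ y /2⌉ ⌊ y /2⌋ ⟩
  splitSegSumSize d ⌈ x /2⌉ ⌊ x /2⌋ ⌈ y /2⌉ ⌊ y /2⌋
    ≡⟨ splitSegSumSize-balanced {d} x-split y-split ⟩
  splitSegSumSize d x₀ x₁ y₀ y₁ ∎
  where open ≤-Reasoning

⊞-∘-linear-involution : (σ : F₂^ n → F₂^ n) →
  (∀ v → σ (σ v) ≡ v) → (∀ a b → σ (a ⊕ b) ≡ σ a ⊕ σ b) →
  (X Y : SubsetF₂ n) → (X ∘ σ) ⊞ (Y ∘ σ) ≐ (X ⊞ Y) ∘ σ
⊞-∘-linear-involution σ σσ≡id σ-⊕ X Y z = T-injective (mk⇔ ⇒ ⇐)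
  where
  ⇒ : T (((X ∘ σ) ⊞ (Y ∘ σ)) z) → T ((X ⊞ Y) (σ z))
  ⇒ z∈ with ⊞-elim z z∈
  ... | a , Xσa , Yσ[z+a] = ⊞-intro (σ z) (σ a) Xσa (subst (T ∘ Y) (σ-⊕ z a) Yσ[z+a])
  ⇐ : T ((X ⊞ Y) (σ z)) → T (((X ∘ σ) ⊞ (Y ∘ σ)) z)
  ⇐ σz∈ with ⊞-elim (σ z) σz∈
  ... | a , Xa , Yσz+a = ⊞-intro z (σ a) (subst (T ∘ X) (sym (σσ≡id a)) Xa)
    (subst (T ∘ Y) (sym (trans (σ-⊕ z (σ a)) (cong (σ z ⊕_) (σσ≡id a)))) Yσz+a)

shear : F₂^ (suc (suc n)) → F₂^ (suc (suc n))
shear (c ∷ q ∷ r) = (c xor q) ∷ q ∷ r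

shear-involutive : (v : F₂^ (suc (suc n))) → shear (shear v) ≡ v
shear-involutive (c ∷ q ∷ r) = cong (λ b → b ∷ q ∷ r) (xor-cancelʳ c q)

shear-⊕ : (a b : F₂^ (suc (suc n))) → shear (a ⊕ b) ≡ shear a ⊕ shear b
shear-⊕ (a₁ ∷ a₂ ∷ r) (b₁ ∷ b₂ ∷ s) =
  cong (λ c → c ∷ (a₂ xor b₂) ∷ (r ⊕ s)) (xor-interchange a₁ b₁ a₂ b₂)

count-∘-shear : (P : SubsetF₂ (suc (suc n))) → count (suc (suc n)) (P ∘ shear) ≡ count (suc (suc n)) P
count-∘-shear {n} P = begin
  (p₀₀ + p₁₁) + (p₁₀ + p₀₁) ≡⟨ +-interchange p₀₀ p₁₁ p₁₀ p₀₁ ⟩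
  (p₀₀ + p₁₀) + (p₁₁ + p₀₁) ≡⟨ cong ((p₀₀ + p₁₀) +_) (+-comm p₁₁ p₀₁) ⟩
  (p₀₀ + p₁₀) + (p₀₁ + p₁₁) ≡⟨ +-interchange p₀₀ p₀₁ p₁₀ p₁₁ ⟨
  (p₀₀ + p₀₁) + (p₁₀ + p₁₁) ∎
  where
  open ≡-Reasoning
  p₀₀ = count n (λ r → P (false ∷ false ∷ r))
  p₀₁ = count n (λ r → P (false ∷ true ∷ r))
  p₁₀ = count n (λ r → P (true ∷ false ∷ r))
  p₁₁ = count n (λ r → P (true ∷ true ∷ r))

count-even-half : ∀ {x} → x ≤ 2 ^ suc n → count n (slice false (segment x)) ≡ ⌈ x /2⌉
count-even-half {n} {x} x≤2^1+n =
  trans (count-cong {n} (segment≐glue x ∘ (false ∷_))) (count-segment {n} (⌈/2⌉≤2^ n x≤2^1+n))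

count-odd-half : ∀ {x} → x ≤ 2 ^ suc n → count n (slice true (segment x)) ≡ ⌊ x /2⌋
count-odd-half {n} {x} x≤2^1+n =
  trans (count-cong {n} (segment≐glue x ∘ (true ∷_))) (count-segment {n} (⌊/2⌋≤2^ n x≤2^1+n))

-- Slice c of S consists of the even half of segment x_c and the odd half of segment x_(1-c).
sheared-glue-balanced : ∀ {x₀ x₁} → x₀ ≤ 2 ^ suc n → x₁ ≤ 2 ^ suc n →
  let S = glue (segment x₀) (segment x₁) ∘ shear in
  Balanced (count (suc n) (slice false S)) (count (suc n) (slice true S)) (x₀ + x₁)
sheared-glue-balanced {n} {x₀} {x₁} x₀≤ x₁≤ =
  subst₂ (λ s₀ s₁ → Balanced s₀ s₁ (x₀ + x₁))
    (sym (cong₂ _+_ (count-even-half {n} x₀≤) (count-odd-half {n} x₁≤)))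
    (sym (cong₂ _+_ (count-even-half {n} x₁≤) (count-odd-half {n} x₀≤)))
    (balanced-halves x₀ x₁)

segSumSize-suc-≤-splitSegSumSize : SegmentsMinimal d → ∀ {x₀ x₁ y₀ y₁} →
  x₀ ≤ 2 ^ d → x₁ ≤ 2 ^ d → y₀ ≤ 2 ^ d → y₁ ≤ 2 ^ d →
  segSumSize (suc d) (x₀ + x₁) (y₀ + y₁) ≤ splitSegSumSize d x₀ x₁ y₀ y₁
segSumSize-suc-≤-splitSegSumSize {zero} _ x₀≤1 x₁≤1 y₀≤1 y₁≤1 =
  segSumSize-suc-≤-balanced {0} (balanced-≤1 x₀≤1 x₁≤1) (balanced-≤1 y₀≤1 y₁≤1)
segSumSize-suc-≤-splitSegSumSize {suc d} minimal {x₀} {x₁} {y₀} {y₁} x₀≤ x₁≤ y₀≤ y₁≤ = begin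
  segSumSize (2 + d) (x₀ + x₁) (y₀ + y₁)
    ≤⟨ segSumSize-suc-≤-balanced {suc d} (sheared-glue-balanced {d} x₀≤ x₁≤)
                                         (sheared-glue-balanced {d} y₀≤ y₁≤) ⟩
  splitSegSumSize (suc d) (count (suc d) (slice false X′)) (count (suc d) (slice true X′))
                          (count (suc d) (slice false Y′)) (count (suc d) (slice true Y′))
    ≤⟨ splitSegSumSize-≤-count-⊞ minimal X′ Y′ ⟩
  count (2 + d) (X′ ⊞ Y′)
    ≡⟨ count-cong {2 + d} (⊞-∘-linear-involution shear shear-involutive shear-⊕ X Y) ⟩
  count (2 + d) ((X ⊞ Y) ∘ shear)
    ≡⟨ count-∘-shear (X ⊞ Y) ⟩
  count (2 + d) (X ⊞ Y)
    ≤⟨ count-⊞-glue-≤ {suc d} x₀ x₁ y₀ y₁ ⟩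
  splitSegSumSize (suc d) x₀ x₁ y₀ y₁ ∎
  where
  open ≤-Reasoning
  X Y : SubsetF₂ (2 + d)
  X = glue (segment x₀) (segment x₁)
  Y = glue (segment y₀) (segment y₁)
  X′ = X ∘ shear
  Y′ = Y ∘ shear

segmentsMinimal : (d : ℕ) → SegmentsMinimal d
segmentsMinimal zero X Y = count-mono {0} segments⊆X+Y
  where
  0<ᵇbit⇒T : ∀ b → T (0 <ᵇ bit b) → T b
  0<ᵇbit⇒T true _ = tt
  segments⊆X+Y : segment (count 0 X) ⊞ segment (count 0 Y) ⊆ X ⊞ Y
  segments⊆X+Y [] []∈ with ⊞-elim [] []∈
  ... | [] , X[] , Y[] = ⊞-intro [] [] (0<ᵇbit⇒T (X []) X[]) (0<ᵇbit⇒T (Y []) Y[])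
segmentsMinimal (suc d) X Y = ≤-trans
  (segSumSize-suc-≤-splitSegSumSize (segmentsMinimal d)
    (count≤2^ (slice false X)) (count≤2^ (slice true X))
    (count≤2^ (slice false Y)) (count≤2^ (slice true Y)))
  (splitSegSumSize-≤-count-⊞ (segmentsMinimal d) X Y)

-- J-fibres and the compression

-- embed J z u agrees with z off J and has J-coordinates u, so A ∘ embed J z is the fibre A_x
-- of the compression, x being the part of z off J.
embed : (J : Subset n) → F₂^ n → F₂^ ∣ J ∣ → F₂^ n
embed []          []      []      = []
embed (false ∷ J) (c ∷ z) u       = c ∷ embed J z u
embed (true ∷ J)  (c ∷ z) (b ∷ u) = b ∷ embed J z u

embed-embed : (J : Subset n) (z : F₂^ n) (u v : F₂^ ∣ J ∣) →
  embed J (embed J z u) v ≡ embed J z v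
embed-embed []          []      []      []      = refl
embed-embed (false ∷ J) (c ∷ z) u       v       = cong (c ∷_) (embed-embed J z u v)
embed-embed (true ∷ J)  (c ∷ z) (b ∷ u) (e ∷ v) = cong (e ∷_) (embed-embed J z u v)

embed-⊕ : (J : Subset n) (z a : F₂^ n) (u s : F₂^ ∣ J ∣) →
  embed J z u ⊕ embed J a s ≡ embed J (z ⊕ a) (u ⊕ s)
embed-⊕ []          []      []      []      []      = refl
embed-⊕ (false ∷ J) (c ∷ z) (e ∷ a) u       s       = cong ((c xor e) ∷_) (embed-⊕ J z a u s)
embed-⊕ (true ∷ J)  (c ∷ z) (e ∷ a) (b ∷ u) (f ∷ s) = cong ((b xor f) ∷_) (embed-⊕ J z a u s)

embed-covers : (J : Subset n) (a : F₂^ n) → ∃ λ s → embed J a s ≡ a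
embed-covers []          []      = [] , refl
embed-covers (false ∷ J) (c ∷ a) = let s , e = embed-covers J a in s , cong (c ∷_) e
embed-covers (true ∷ J)  (c ∷ a) = let s , e = embed-covers J a in c ∷ s , cong (c ∷_) e

count-agreeOff : (J : Subset n) (z : F₂^ n) (P : SubsetF₂ n) →
  count n (λ w → agreeOff J z w ∧ P w) ≡ count (∣ J ∣) (P ∘ embed J z)
count-agreeOff []                []          P = refl
count-agreeOff {suc n} (false ∷ J) (false ∷ z) P =
  trans (cong₂ _+_ (count-agreeOff J z (slice false P)) (count-empty n)) (+-identityʳ _)
count-agreeOff {suc n} (false ∷ J) (true ∷ z)  P =
  cong₂ _+_ (count-empty n) (count-agreeOff J z (slice true P))
count-agreeOff (true ∷ J)  (c ∷ z)     P =
  cong₂ _+_ (count-agreeOff J z (slice false P)) (count-agreeOff J z (slice true P))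

-- Stated for ℕ-valued functions because at a coordinate in J the two halves of every fibre
-- are merged into a single function.
cubeSum-≤-fibrewise : (J : Subset n) {f g : F₂^ n → ℕ} →
  (∀ z → cubeSum (∣ J ∣) (f ∘ embed J z) ≤ cubeSum (∣ J ∣) (g ∘ embed J z)) →
  cubeSum n f ≤ cubeSum n g
cubeSum-≤-fibrewise []          f≤g = f≤g []
cubeSum-≤-fibrewise (false ∷ J) f≤g =
  +-mono-≤ (cubeSum-≤-fibrewise J (f≤g ∘ (false ∷_))) (cubeSum-≤-fibrewise J (f≤g ∘ (true ∷_)))
cubeSum-≤-fibrewise {suc n} (true ∷ J) {f} {g} f≤g = begin
  cubeSum n (f ∘ (false ∷_)) + cubeSum n (f ∘ (true ∷_))
    ≡⟨ cubeSum-+ (f ∘ (false ∷_)) (f ∘ (true ∷_)) ⟨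
  cubeSum n f₀+f₁
    ≤⟨ cubeSum-≤-fibrewise J fibre≤ ⟩
  cubeSum n g₀+g₁
    ≡⟨ cubeSum-+ (g ∘ (false ∷_)) (g ∘ (true ∷_)) ⟩
  cubeSum n (g ∘ (false ∷_)) + cubeSum n (g ∘ (true ∷_)) ∎
  where
  open ≤-Reasoning
  f₀+f₁ g₀+g₁ : F₂^ n → ℕ
  f₀+f₁ w = f (false ∷ w) + f (true ∷ w)
  g₀+g₁ w = g (false ∷ w) + g (true ∷ w)
  fibre≤ : ∀ z → cubeSum (∣ J ∣) (f₀+f₁ ∘ embed J z) ≤ cubeSum (∣ J ∣) (g₀+g₁ ∘ embed J z)
  fibre≤ z = subst₂ _≤_
    (sym (cubeSum-+ (λ u → f (false ∷ embed J z u)) (λ u → f (true ∷ embed J z u))))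
    (sym (cubeSum-+ (λ u → g (false ∷ embed J z u)) (λ u → g (true ∷ embed J z u))))
    (f≤g (false ∷ z))

agreeOn-embed⁻ : (J : Subset n) (z : F₂^ n) (u t : F₂^ ∣ J ∣) →
  T (agreeOn J (embed J z u) (embed J z t)) → u ≡ t
agreeOn-embed⁻ []          []      []      []      _  = refl
agreeOn-embed⁻ (false ∷ J) (c ∷ z) u       t       on = agreeOn-embed⁻ J z u t on
agreeOn-embed⁻ (true ∷ J)  (c ∷ z) (b ∷ u) (e ∷ t) on =
  cong₂ _∷_ (b≡e b e (proj₁ (to T-∧ on))) (agreeOn-embed⁻ J z u t (proj₂ (to T-∧ on)))
  where
  b≡e : ∀ b e → T (not (b xor e)) → b ≡ e
  b≡e false false _ = refl
  b≡e true  true  _ = refl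

agreeOn-embed-refl : (J : Subset n) (z : F₂^ n) (u : F₂^ ∣ J ∣) →
  T (agreeOn J (embed J z u) (embed J z u))
agreeOn-embed-refl []          []      []      = tt
agreeOn-embed-refl (false ∷ J) (c ∷ z) u       = agreeOn-embed-refl J z u
agreeOn-embed-refl (true ∷ J)  (c ∷ z) (b ∷ u) =
  from T-∧ (subst (T ∘ not) (sym (xor-same b)) tt , agreeOn-embed-refl J z u)

T-not∧ : ∀ b e → T (not b ∧ e) → b ≡ false × e ≡ true
T-not∧ false true _ = refl , refl

lexLt-embed⁻ : (J : Subset n) (z : F₂^ n) (u t : F₂^ ∣ J ∣) →
  T (lexLt J (embed J z u) (embed J z t)) → val u < val t
lexLt-embed⁻ []          []      []      []      ()
lexLt-embed⁻ (false ∷ J) (c ∷ z) u t u≺t with to T-∨ u≺t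
... | inj₁ u≺t′     = lexLt-embed⁻ J z u t u≺t′
... | inj₂ on∧false = ⊥-elim (proj₂ (to T-∧ on∧false))
lexLt-embed⁻ (true ∷ J) (c ∷ z) (b ∷ u) (e ∷ t) u≺t with to T-∨ u≺t
... | inj₁ u≺t′ = bit+*2-< b e (lexLt-embed⁻ J z u t u≺t′)
... | inj₂ on∧b<e with to T-∧ on∧b<e
...   | on , b<e with agreeOn-embed⁻ J z u t on | T-not∧ b e b<e
...     | refl | refl , refl = ≤-refl

lexLt-embed⁺ : (J : Subset n) (z : F₂^ n) (u t : F₂^ ∣ J ∣) →
  val u < val t → T (lexLt J (embed J z u) (embed J z t))
lexLt-embed⁺ []          []      []      []      ()
lexLt-embed⁺ (false ∷ J) (c ∷ z) u t u<t = from T-∨ (inj₁ (lexLt-embed⁺ J z u t u<t))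
lexLt-embed⁺ (true ∷ J) (c ∷ z) (b ∷ u) (e ∷ t) bu<et with val-∷-<⁻ u t bu<et
... | inj₁ u<t                 = from T-∨ (inj₁ (lexLt-embed⁺ J z u t u<t))
... | inj₂ (refl , refl , refl) = from T-∨ (inj₂ (from T-∧ (agreeOn-embed-refl J z u , tt)))

lexLt-embed : (J : Subset n) (z : F₂^ n) (u t : F₂^ ∣ J ∣) →
  lexLt J (embed J z u) (embed J z t) ≡ segment (val t) u
lexLt-embed J z u t =
  T-injective (mk⇔ (<⇒<ᵇ ∘ lexLt-embed⁻ J z u t) (lexLt-embed⁺ J z u t ∘ <ᵇ⇒< (val u) (val t)))

compress-embed : (J : Subset n) (A : SubsetF₂ n) (z : F₂^ n) (t : F₂^ ∣ J ∣) →
  compress J A (embed J z t) ≡ segment (count (∣ J ∣) (A ∘ embed J z)) t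
compress-embed {n} J A z t = begin
  compress J A w
    ≡⟨ cong₂ _<ᵇ_ (length-filter-allVecs (λ v → agreeOff J w v ∧ lexLt J v w))
                  (length-filter-allVecs (λ v → agreeOff J w v ∧ A v)) ⟩
  count n (λ v → agreeOff J w v ∧ lexLt J v w) <ᵇ count n (λ v → agreeOff J w v ∧ A v)
    ≡⟨ cong₂ _<ᵇ_ (count-agreeOff J w (λ v → lexLt J v w)) (count-agreeOff J w A) ⟩
  count (∣ J ∣) (λ u → lexLt J (embed J w u) w) <ᵇ count (∣ J ∣) (A ∘ embed J w)
    ≡⟨ cong₂ _<ᵇ_ (count-cong {∣ J ∣} (λ u → cong (λ v → lexLt J v w) (embed-embed J z t u)))
                  (count-cong {∣ J ∣} (λ u → cong A (embed-embed J z t u))) ⟩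
  count (∣ J ∣) (λ u → lexLt J (embed J z u) w) <ᵇ count (∣ J ∣) (A ∘ embed J z)
    ≡⟨ cong (_<ᵇ count (∣ J ∣) (A ∘ embed J z))
            (trans (count-cong {∣ J ∣} (λ u → lexLt-embed J z u t))
                   (count-segment {∣ J ∣} (<⇒≤ (val<2^ t)))) ⟩
  val t <ᵇ count (∣ J ∣) (A ∘ embed J z) ∎
  where
  open ≡-Reasoning
  w = embed J z t

fibre-⊞⁻ : (J : Subset n) {X Y : SubsetF₂ n} (z : F₂^ n) (u : F₂^ ∣ J ∣) →
  T ((X ⊞ Y) (embed J z u)) → ∃₂ λ a s → T (X (embed J a s)) × T (Y (embed J (z ⊕ a) (u ⊕ s)))
fibre-⊞⁻ J {X} {Y} z u u∈X+Y with ⊞-elim (embed J z u) u∈X+Y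
... | a , Xa , Y[z+a] with embed-covers J a
...   | s , as≡a = a , s , subst (T ∘ X) (sym as≡a) Xa ,
  subst (T ∘ Y) (trans (cong (embed J z u ⊕_) (sym as≡a)) (embed-⊕ J z a u s)) Y[z+a]

fibre-⊞⁺ : (J : Subset n) {X Y : SubsetF₂ n} (z a : F₂^ n) →
  (X ∘ embed J a) ⊞ (Y ∘ embed J (z ⊕ a)) ⊆ (X ⊞ Y) ∘ embed J z
fibre-⊞⁺ J {X} {Y} z a u u∈ with ⊞-elim u u∈
... | s , X[a,s] , Y[z+a,u+s] =
  ⊞-intro (embed J z u) (embed J a s) X[a,s] (subst (T ∘ Y) (sym (embed-⊕ J z a u s)) Y[z+a,u+s])

count-compress-fibre : (J : Subset n) (A : SubsetF₂ n) (z : F₂^ n) →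
  count (∣ J ∣) (compress J A ∘ embed J z) ≡ count (∣ J ∣) (A ∘ embed J z)
count-compress-fibre J A z =
  trans (count-cong {∣ J ∣} (compress-embed J A z)) (count-segment {∣ J ∣} (count≤2^ (A ∘ embed J z)))

count-compress : (J : Subset n) (A : SubsetF₂ n) → count n (compress J A) ≡ count n A
count-compress J A = ≤-antisym
  (cubeSum-≤-fibrewise J (≤-reflexive ∘ count-compress-fibre J A))
  (cubeSum-≤-fibrewise J (≤-reflexive ∘ sym ∘ count-compress-fibre J A))

compress-⊞-fibre⊆segment : (J : Subset n) (A B : SubsetF₂ n) (z : F₂^ n) →
  (compress J A ⊞ compress J B) ∘ embed J z ⊆ segment (count (∣ J ∣) ((A ⊞ B) ∘ embed J z))
compress-⊞-fibre⊆segment J A B z u u∈ with fibre-⊞⁻ J z u u∈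
... | a , s , C[a,s] , C[z+a,u+s] = <⇒<ᵇ (begin-strict
  val u
    <⟨ downset-val<count (⊞-isDownset (segment-isDownset ∣A[a]∣) (segment-isDownset ∣B[z+a]∣))
                         u u∈segments ⟩
  segSumSize (∣ J ∣) ∣A[a]∣ ∣B[z+a]∣
    ≤⟨ segmentsMinimal (∣ J ∣) (A ∘ embed J a) (B ∘ embed J (z ⊕ a)) ⟩
  count (∣ J ∣) ((A ∘ embed J a) ⊞ (B ∘ embed J (z ⊕ a)))
    ≤⟨ count-mono {∣ J ∣} (fibre-⊞⁺ J z a) ⟩
  count (∣ J ∣) ((A ⊞ B) ∘ embed J z) ∎)
  where
  open ≤-Reasoning
  ∣A[a]∣ = count (∣ J ∣) (A ∘ embed J a)
  ∣B[z+a]∣ = count (∣ J ∣) (B ∘ embed J (z ⊕ a))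
  u∈segments : T ((segment ∣A[a]∣ ⊞ segment ∣B[z+a]∣) u)
  u∈segments = ⊞-intro u s (subst T (compress-embed J A a s) C[a,s])
                           (subst T (compress-embed J B (z ⊕ a) (u ⊕ s)) C[z+a,u+s])

count-⊞-compress : (J : Subset n) (A B : SubsetF₂ n) →
  count n (compress J A ⊞ compress J B) ≤ count n (A ⊞ B)
count-⊞-compress J A B = cubeSum-≤-fibrewise J (λ z →
  ≤-trans (count-mono {∣ J ∣} (compress-⊞-fibre⊆segment J A B z)) (count-segment-≤ {∣ J ∣} _))

-- Non-emptiness of A is only needed for σ to be defined: the cross-multiplied inequality
-- follows for every A from |C + C| ≤ |A + A| and |C| = |A|.
corollary2p10 : (n : ℕ) (J : Subset n) (A : SubsetF₂ n) →
    ∃ (λ a → A a ≡ true) →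
    card (sumset (compress J A)) * card A ≤ card (sumset A) * card (compress J A)
corollary2p10 n J A _ = *-mono-≤ ∣C+C∣≤∣A+A∣ (≤-reflexive ∣A∣≡∣C∣)
  where
  C = compress J A
  card-sumset : (X : SubsetF₂ n) → card (sumset X) ≡ count n (X ⊞ X)
  card-sumset X = trans (card≡count (sumset X)) (count-cong {n} (sumset≐⊞ X))
  ∣C+C∣≤∣A+A∣ : card (sumset C) ≤ card (sumset A)
  ∣C+C∣≤∣A+A∣ = subst₂ _≤_ (sym (card-sumset C)) (sym (card-sumset A)) (count-⊞-compress J A A)
  ∣A∣≡∣C∣ : card A ≡ card C
  ∣A∣≡∣C∣ = trans (card≡count A) (trans (sym (count-compress J A)) (sym (card≡count C)))
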